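{- For all positive integers $n,k$, $D(n,k)\leqslant \binom{n}{k-1}$.
   Context: All graphs are finite, simple and undirected. For a graph $G$ and an integer $k\geq 1$, the $k$-configuration graph $\mathcal{R}_k(G)$ (token jumping model) is the graph whose vertices are the independent sets of $G$ of size exactly $k$, where two such independent sets $I,J$ are adjacent if and only if $|I\cap J|=k-1$. $D(n,k)$ denotes the maximum, over all graphs $G$ on $n$ vertices, of the largest diameter of a connected component of $\mathcal{R}_k(G)$. -}

module Defs where

open import Data.Nat using (ℕ; zero; suc; _∸_)
open import Data.Bool using (Bool; true; false)
open import Data.Fin using (Fin)
open import Data.Fin.Subset using (Subset; _∈_; _∩_; ∣_∣)
open import Data.Product using (_×_)
open import Relation.Binary.PropositionalEquality using (_≡_)

record Graph (n : ℕ) : Set where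
  field
    adj     : Fin n → Fin n → Bool
    symm    : ∀ u v → adj u v ≡ adj v u
    irrefl  : ∀ v → adj v v ≡ false
open Graph public

Independent : ∀ {n} → Graph n → Subset n → Set
Independent G I = ∀ u v → u ∈ I → v ∈ I → adj G u v ≡ false

IndepK : ∀ {n} → Graph n → ℕ → Subset n → Set
IndepK G k I = Independent G I × ∣ I ∣ ≡ k

-- adjacency in the k-configuration graph R_k(G) (token jumping):
-- both are independent k-sets and |I ∩ J| = k - 1
RAdj : ∀ {n} → Graph n → ℕ → Subset n → Subset n → Set
RAdj G k I J = IndepK G k I × IndepK G k J × ∣ I ∩ J ∣ ≡ k ∸ 1

data Walk {n : ℕ} (G : Graph n) (k : ℕ) : Subset n → Subset n → ℕ → Set where
  here : ∀ {I} → Walk G k I I zero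
  step : ∀ {I J K m} → RAdj G k I J → Walk G k J K m → Walk G k I K (suc m)

{-# OPTIONS --safe #-}
module Submission where

-- Call I ∩ J, a (k-1)-set, the pivot of a step I → J of R_k(G). Any walk can be
-- shortened until no pivot occurs twice: if the pivot S of the step I → J occurs
-- again later, at a step B → B′, then I and B′ are independent k-sets containing S,
-- so either I = B′ or I → B′ is a step with pivot S, and everything in between can
-- be cut out. A walk with pairwise distinct pivots has at most C(n,k-1) steps.

open import Defs
open import Data.Bool.Base using (Bool; true; false)
open import Data.Bool.Properties using () renaming (_≟_ to _≟ᵇ_)
open import Data.Empty using (⊥-elim)
open import Data.Fin.Subset using (Subset; _⊆_; _∩_; ∣_∣; inside; outside)
open import Data.Fin.Subset.Properties
  using (p⊆q⇒∣p∣≤∣q∣; p∩q⊆p; p∩q⊆q; x∈p∩q⁺; ∣p∩q∣≤∣p∣; drop-∷-⊆; ⊆-trans; ⊆-reflexive)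
open import Data.List.Base using (List; []; _∷_; length)
open import Data.List.Membership.Propositional using (_∈_)
open import Data.List.Relation.Unary.All as All using (All; []; _∷_)
open import Data.List.Relation.Unary.All.Properties using (¬Any⇒All¬)
open import Data.List.Relation.Unary.AllPairs using ([]; _∷_)
open import Data.List.Relation.Unary.Any using (here; there; any?)
open import Data.List.Relation.Unary.Unique.Propositional using (Unique)
open import Data.Nat.Base using (ℕ; zero; suc; _+_; _≤_; _∸_; s≤s; z≤n)
open import Data.Nat.Combinatorics using (_C_; nCk+nC[k+1]≡[n+1]C[k+1])
open import Data.Nat.Properties
  using (≤-refl; ≤-antisym; ≤-pred; ≤∧≢⇒<; <⇒≢; +-mono-≤; +-suc; suc-injective; module ≤-Reasoning)
open import Data.Product using (Σ; ∃; _×_; _,_; proj₂)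
open import Data.Vec.Base using ([]; _∷_; here)
open import Data.Vec.Properties using (≡-dec)
open import Relation.Binary.Definitions using (DecidableEquality)
open import Relation.Binary.PropositionalEquality
open import Relation.Nullary using (yes; no)

private
  variable
    n k m : ℕ

infix 4 _≟ˢ_
_≟ˢ_ : DecidableEquality (Subset n)
_≟ˢ_ = ≡-dec _≟ᵇ_

p⊆q∧∣p∣≡∣q∣⇒p≡q : {p q : Subset n} → p ⊆ q → ∣ p ∣ ≡ ∣ q ∣ → p ≡ q
p⊆q∧∣p∣≡∣q∣⇒p≡q {p = []} {[]} _ _ = refl
p⊆q∧∣p∣≡∣q∣⇒p≡q {p = outside ∷ p} {outside ∷ q} p⊆q e =
  cong (outside ∷_) (p⊆q∧∣p∣≡∣q∣⇒p≡q (drop-∷-⊆ p⊆q) e)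
p⊆q∧∣p∣≡∣q∣⇒p≡q {p = outside ∷ p} {inside ∷ q} p⊆q e =
  ⊥-elim (<⇒≢ (s≤s (p⊆q⇒∣p∣≤∣q∣ (drop-∷-⊆ p⊆q))) e)
p⊆q∧∣p∣≡∣q∣⇒p≡q {p = inside ∷ p} {outside ∷ q} p⊆q e with p⊆q here
... | ()
p⊆q∧∣p∣≡∣q∣⇒p≡q {p = inside ∷ p} {inside ∷ q} p⊆q e =
  cong (inside ∷_) (p⊆q∧∣p∣≡∣q∣⇒p≡q (drop-∷-⊆ p⊆q) (suc-injective e))

∣p∩q∣≡∣p∣⇒p⊆q : (p q : Subset n) → ∣ p ∩ q ∣ ≡ ∣ p ∣ → p ⊆ q
∣p∩q∣≡∣p∣⇒p⊆q p q e =
  ⊆-trans (⊆-reflexive (sym (p⊆q∧∣p∣≡∣q∣⇒p≡q (p∩q⊆p p q) e))) (p∩q⊆q p q)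

distinct-extensions-meet-in : {p q s : Subset n} → ∣ p ∣ ≡ suc k → ∣ q ∣ ≡ suc k → ∣ s ∣ ≡ k →
                              s ⊆ p → s ⊆ q → p ≢ q → p ∩ q ≡ s
distinct-extensions-meet-in {k = k} {p} {q} {s} ∣p∣ ∣q∣ ∣s∣ s⊆p s⊆q p≢q =
  sym (p⊆q∧∣p∣≡∣q∣⇒p≡q s⊆p∩q (trans ∣s∣ (sym ∣p∩q∣≡k)))
  where
  s⊆p∩q : s ⊆ p ∩ q
  s⊆p∩q x∈s = x∈p∩q⁺ (s⊆p x∈s , s⊆q x∈s)
  ∣p∩q∣≢1+k : ∣ p ∩ q ∣ ≢ suc k
  ∣p∩q∣≢1+k e =
    p≢q (p⊆q∧∣p∣≡∣q∣⇒p≡q (∣p∩q∣≡∣p∣⇒p⊆q p q (trans e (sym ∣p∣))) (trans ∣p∣ (sym ∣q∣)))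
  ∣p∩q∣≡k : ∣ p ∩ q ∣ ≡ k
  ∣p∩q∣≡k = ≤-antisym (≤-pred (≤∧≢⇒< (subst (∣ p ∩ q ∣ ≤_) ∣p∣ (∣p∩q∣≤∣p∣ p q)) ∣p∩q∣≢1+k))
                      (subst (_≤ ∣ p ∩ q ∣) ∣s∣ (p⊆q⇒∣p∣≤∣q∣ s⊆p∩q))

strip : Bool → List (Subset (suc n)) → List (Subset n)
strip b [] = []
strip b ((c ∷ p) ∷ ps) with b ≟ᵇ c
... | yes _ = p ∷ strip b ps
... | no _  = strip b ps

∈-strip⁻ : (b : Bool) (ps : List (Subset (suc n))) {p : Subset n} → p ∈ strip b ps → (b ∷ p) ∈ ps
∈-strip⁻ b ((c ∷ q) ∷ ps) p∈ with b ≟ᵇ c | p∈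
... | yes refl | here refl = here refl
... | yes refl | there p∈′ = there (∈-strip⁻ b ps p∈′)
... | no _     | p∈′       = there (∈-strip⁻ b ps p∈′)

All-strip : {P : Subset (suc n) → Set} (b : Bool) {ps : List (Subset (suc n))} →
            All P ps → All (λ p → P (b ∷ p)) (strip b ps)
All-strip b {ps} all = All.tabulate (λ p∈ → All.lookup all (∈-strip⁻ b ps p∈))

Unique-strip : (b : Bool) {ps : List (Subset (suc n))} → Unique ps → Unique (strip b ps)
Unique-strip b {[]} [] = []
Unique-strip b {(c ∷ p) ∷ ps} (p∉ps ∷ u) with b ≟ᵇ c
... | yes refl =
  All.map (λ b∷p≢b∷q p≡q → b∷p≢b∷q (cong (b ∷_) p≡q)) (All-strip b p∉ps) ∷ Unique-strip b u
... | no _     = Unique-strip b u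

length-strip : (ps : List (Subset (suc n))) →
               length ps ≡ length (strip true ps) + length (strip false ps)
length-strip [] = refl
length-strip ((true ∷ p) ∷ ps) = cong suc (length-strip ps)
length-strip ((false ∷ p) ∷ ps) = trans (cong suc (length-strip ps)) (sym (+-suc _ _))

All-∣∣≡0⇒strip-true≡[] : {ps : List (Subset (suc n))} → All (λ p → ∣ p ∣ ≡ 0) ps → strip true ps ≡ []
All-∣∣≡0⇒strip-true≡[] {ps = ps} sizes with strip true ps | All-strip true sizes
... | [] | _ = refl
... | _ ∷ _ | () ∷ _

Unique⇒length≤C : ∀ n r {ps : List (Subset n)} →
                            Unique ps → All (λ p → ∣ p ∣ ≡ r) ps → length ps ≤ n C r
Unique⇒length≤C zero r {[]} _ _ = z≤n
Unique⇒length≤C zero r {[] ∷ []} _ (refl ∷ []) = ≤-refl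
Unique⇒length≤C zero r {[] ∷ [] ∷ _} (([]≢[] ∷ _) ∷ _) _ = ⊥-elim ([]≢[] refl)
Unique⇒length≤C (suc n) zero {ps} u sizes = begin
  length ps                                          ≡⟨ length-strip ps ⟩
  length (strip true ps) + length (strip false ps)   ≡⟨ cong (λ xs → length xs + length (strip false ps))
                                                              (All-∣∣≡0⇒strip-true≡[] sizes) ⟩
  length (strip false ps)                            ≤⟨ Unique⇒length≤C n 0 (Unique-strip false u)
                                                                        (All-strip false sizes) ⟩
  suc n C 0                                          ∎
  where open ≤-Reasoning
Unique⇒length≤C (suc n) (suc r) {ps} u sizes = begin
  length ps                                          ≡⟨ length-strip ps ⟩
  length (strip true ps) + length (strip false ps)   ≤⟨ +-mono-≤ containing-0 avoiding-0 ⟩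
  n C r + n C suc r                                  ≡⟨ nCk+nC[k+1]≡[n+1]C[k+1] n r ⟩
  suc n C suc r                                      ∎
  where
  open ≤-Reasoning
  containing-0 : length (strip true ps) ≤ n C r
  containing-0 = Unique⇒length≤C n r (Unique-strip true u) (All.map suc-injective (All-strip true sizes))
  avoiding-0 : length (strip false ps) ≤ n C suc r
  avoiding-0 = Unique⇒length≤C n (suc r) (Unique-strip false u) (All-strip false sizes)

module _ {G : Graph n} where

  pivots : {I J : Subset n} → Walk G k I J m → List (Subset n)
  pivots here = []
  pivots (step {I} {J} _ w) = I ∩ J ∷ pivots w

  length-pivots : {I J : Subset n} (w : Walk G k I J m) → length (pivots w) ≡ m
  length-pivots here = refl
  length-pivots (step _ w) = cong suc (length-pivots w)

  All-∣pivot∣≡k∸1 : {I J : Subset n} (w : Walk G k I J m) → All (λ p → ∣ p ∣ ≡ k ∸ 1) (pivots w)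
  All-∣pivot∣≡k∸1 here = []
  All-∣pivot∣≡k∸1 (step (_ , _ , ∣I∩J∣) w) = ∣I∩J∣ ∷ All-∣pivot∣≡k∸1 w

  record UniquePivotWalk (k : ℕ) (I K : Subset n) : Set where
    field
      {steps} : ℕ
      walk    : Walk G k I K steps
      unique  : Unique (pivots walk)

  record WalkAfterPivot (k : ℕ) (S K : Subset n) : Set where
    field
      {start}        : Subset n
      {steps}        : ℕ
      start-indep    : IndepK G k start
      pivot⊆start    : S ⊆ start
      walk           : Walk G k start K steps
      unique-pivot∷  : Unique (S ∷ pivots walk)

  walk-after-pivot : {S J K : Subset n} (w : Walk G k J K m) →
                     Unique (pivots w) → S ∈ pivots w → WalkAfterPivot k S K
  walk-after-pivot (step {J} {J′} (_ , J′-indep , _) w) u (here refl) = record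
    { start-indep = J′-indep ; pivot⊆start = p∩q⊆q J J′ ; walk = w ; unique-pivot∷ = u }
  walk-after-pivot (step _ w) (_ ∷ u) (there S∈) = walk-after-pivot w u S∈

  shortcut : {I J K : Subset n} → RAdj G (suc k) I J → WalkAfterPivot (suc k) (I ∩ J) K →
             UniquePivotWalk (suc k) I K
  shortcut {I = I} _ after with I ≟ˢ WalkAfterPivot.start after
  shortcut _ record { walk = rest ; unique-pivot∷ = _ ∷ u } | yes refl =
    record { walk = rest ; unique = u }
  shortcut {I = I} {J} ((I-indep , ∣I∣) , _ , ∣I∩J∣) after | no I≢start =
    record { walk = step ((I-indep , ∣I∣) , start-indep , trans (cong ∣_∣ I∩start≡I∩J) ∣I∩J∣) walk
           ; unique = subst (λ s → Unique (s ∷ pivots walk)) (sym I∩start≡I∩J) unique-pivot∷ }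
    where
    open WalkAfterPivot after
    I∩start≡I∩J : I ∩ start ≡ I ∩ J
    I∩start≡I∩J =
      distinct-extensions-meet-in ∣I∣ (proj₂ start-indep) ∣I∩J∣ (p∩q⊆p I J) pivot⊆start I≢start

  remove-repeated-pivots : {I K : Subset n} → Walk G (suc k) I K m → UniquePivotWalk (suc k) I K
  remove-repeated-pivots here = record { walk = here ; unique = [] }
  remove-repeated-pivots (step {I} {J} I→J w) with remove-repeated-pivots w
  ... | record { walk = w′ ; unique = u } with any? (I ∩ J ≟ˢ_) (pivots w′)
  ...   | yes I∩J∈ = shortcut I→J (walk-after-pivot w′ u I∩J∈)
  ...   | no I∩J∉  = record { walk = step I→J w′ ; unique = ¬Any⇒All¬ (pivots w′) I∩J∉ ∷ u }

  shorten-walk : {I K : Subset n} → Walk G (suc k) I K m →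
                 ∃ λ m′ → m′ ≤ n C k × Walk G (suc k) I K m′
  shorten-walk {k = k} w with remove-repeated-pivots w
  ... | record { walk = w′ ; unique = u } =
    _ , subst (_≤ n C k) (length-pivots w′) (Unique⇒length≤C n k u (All-∣pivot∣≡k∸1 w′)) , w′

mainTheorem4 : (n k : ℕ) → 1 ≤ n → 1 ≤ k → (G : Graph n) → (I J : Subset n) →
    IndepK G k I → IndepK G k J →
    (∃ λ m → Walk G k I J m) →
    Σ ℕ λ m → m ≤ n C (k ∸ 1) × Walk G k I J m
mainTheorem4 n (suc k) _ _ G I J _ _ (_ , w) = shorten-walk w
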